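{- Let $\mathcal{Q}$ be a seminormal quasi-crystal of type $A_{n-1}$ satisfying axioms LQ1 and LQ2, and let $x,y\in\mathcal{Q}$ and $i\in I$ with $\ddot e_i(x)=y$. (1) Suppose $i+1\in I$. If $\ddot\varepsilon_{i+1}(y)=+\infty$, then $\ddot\varepsilon_{i+1}(x)=+\infty$, and there exists $k>0$ such that $\ddot\varepsilon_{i+1}(\ddot e_i^{k}(y))\notin\{0,+\infty\}$ and $\ddot\varepsilon_i(\ddot e_i^{l}(y))\notin\{0,+\infty\}$ for all $0\le l<k$. (2) Suppose $i-1\in I$. If $\ddot\varphi_{i-1}(x)=+\infty$, then $\ddot\varphi_{i-1}(y)=+\infty$, and there exists $k>0$ such that $\ddot\varphi_{i-1}(\ddot f_i^{k}(x))\notin\{0,+\infty\}$ and $\ddot\varphi_{i}(\ddot f_i^{l}(x))\notin\{0,+\infty\}$ for all $0\le l<k$.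
   Context: Fix $n\ge 2$, $I=\{1,\dots,n-1\}$, weights in $\mathbb{Z}^n$ with standard inner product, $\alpha_i=\mathbf{e}_i-\mathbf{e}_{i+1}$; on $\mathbb{Z}\sqcup\{\pm\infty\}$, $m+(\pm\infty)=\pm\infty$. A quasi-crystal of type $A_{n-1}$ is a non-empty set $\mathcal{Q}$ with maps $\ddot e_i,\ddot f_i:\mathcal{Q}\to\mathcal{Q}\sqcup\{\bot\}$, $\ddot\varepsilon_i,\ddot\varphi_i:\mathcal{Q}\to\mathbb{Z}\sqcup\{\pm\infty\}$, $\mathrm{wt}:\mathcal{Q}\to\mathbb{Z}^n$ with: (Q1) $\ddot e_i(x)=y\iff x=\ddot f_i(y)$, and then $\mathrm{wt}(y)=\mathrm{wt}(x)+\alpha_i$, $\ddot\varepsilon_i(y)=\ddot\varepsilon_i(x)-1$, $\ddot\varphi_i(y)=\ddot\varphi_i(x)+1$; (Q2) $\ddot\varphi_i(x)=\ddot\varepsilon_i(x)+\langle\mathrm{wt}(x),\alpha_i\rangle$; (Q3),(Q4) if $\ddot\varepsilon_i(x)=\pm\infty$ then $\ddot e_i(x)=\ddot f_i(x)=\bot$. Seminormal: whenever $\ddot\varepsilon_i(x)\ne+\infty$, $\ddot\varepsilon_i(x)=\max\{k:\ddot e_i^k(x)\ne\bot\}$ and $\ddot\varphi_i(x)=\max\{k:\ddot f_i^k(x)\ne\bot\}$ (so all values lie in $\mathbb{Z}_{\ge0}\sqcup\{+\infty\}$). Axioms (all $i,j\in I$, $x,y$): (LQ1) for $i+1\in I$: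 $\ddot\varepsilon_i(x)=0\iff\ddot\varphi_{i+1}(x)=0$. (LQ2) if $\ddot e_i(x)=y$: (1) $\ddot\varepsilon_j(x)=\ddot\varepsilon_j(y)$ for $|i-j|>1$; (2) if $i+1\in I$: $\ddot\varepsilon_{i+1}(x)\ne\ddot\varepsilon_{i+1}(y)$ iff ($\ddot\varepsilon_{i+1}(x)=+\infty$ and $\ddot\varepsilon_i(y)=0$), and then $\ddot\varepsilon_{i+1}(y)\ne0$; (3) if $i-1\in I$: $\ddot\varphi_{i-1}(x)\ne\ddot\varphi_{i-1}(y)$ iff ($\ddot\varphi_{i-1}(y)=+\infty$ and $\ddot\varphi_i(x)=0$), and then $\ddot\varphi_{i-1}(x)\ne0$. -}

module Defs where

open import Data.Nat using (ℕ; zero; suc; _≤_; _<_; _∸_; pred; _≡ᵇ_)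
open import Data.Integer using (ℤ; +_; -[1+_]; _-_) renaming (_+_ to _+ℤ_; _*_ to _*ℤ_)
open import Data.Fin using (Fin; toℕ) renaming (zero to fzero; suc to fsuc)
open import Data.Bool using (if_then_else_)
open import Data.Maybe using (Maybe; just; nothing; _>>=_)
open import Data.Product using (Σ; _×_; _,_; ∃)
open import Data.Sum using (_⊎_)
open import Relation.Binary.PropositionalEquality using (_≡_; _≢_)

data ℤ∞ : Set where
  fin : ℤ → ℤ∞
  +∞  : ℤ∞
  -∞  : ℤ∞

infixr 5 _⊕_
_⊕_ : ℤ → ℤ∞ → ℤ∞
m ⊕ fin k = fin (m +ℤ k)
m ⊕ +∞ = +∞
m ⊕ -∞ = -∞

0∞ : ℤ∞
0∞ = fin (+ 0)

Weight : ℕ → Set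
Weight n = Fin n → ℤ

⟨_,_⟩ : {n : ℕ} → Weight n → Weight n → ℤ
⟨_,_⟩ {zero}  w v = + 0
⟨_,_⟩ {suc n} w v = (w fzero *ℤ v fzero) +ℤ ⟨ (λ j → w (fsuc j)) , (λ j → v (fsuc j)) ⟩

-- standard basis vector 𝐞_k (1-indexed: 𝐞_1, …, 𝐞_n)
𝐞 : (n k : ℕ) → Weight n
𝐞 n k j = if (suc (toℕ j) ≡ᵇ k) then + 1 else + 0

α : (n i : ℕ) → Weight n
α n i j = 𝐞 n i j - 𝐞 n (suc i) j

InI : ℕ → ℕ → Set
InI n i = (1 ≤ i) × (suc i ≤ n)

iter : {A : Set} → (A → Maybe A) → ℕ → A → Maybe A
iter g zero    x = just x
iter g (suc k) x = iter g k x >>= g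

-- Quasi-crystals of type A_{n-1}.
-- The operators are indexed by i : ℕ; only the values for i ∈ I
-- (i.e. InI n i) are constrained, the others are irrelevant.

record QuasiCrystal (n : ℕ) : Set₁ where
  field
    Q   : Set
    inh : Q
    ë f̈ : ℕ → Q → Maybe Q
    ε̈ φ̈ : ℕ → Q → ℤ∞
    wt  : Q → Weight n
    Q1-ef  : ∀ i → InI n i → ∀ x y → ë i x ≡ just y → f̈ i y ≡ just x
    Q1-fe  : ∀ i → InI n i → ∀ x y → f̈ i y ≡ just x → ë i x ≡ just y
    Q1-wt  : ∀ i → InI n i → ∀ x y → ë i x ≡ just y →
             ∀ j → wt y j ≡ wt x j +ℤ α n i j
    Q1-ε   : ∀ i → InI n i → ∀ x y → ë i x ≡ just y → ε̈ i y ≡ (-[1+ 0 ] ⊕ ε̈ i x)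
    Q1-φ   : ∀ i → InI n i → ∀ x y → ë i x ≡ just y → φ̈ i y ≡ (+ 1 ⊕ φ̈ i x)
    Q2     : ∀ i → InI n i → ∀ x → φ̈ i x ≡ (⟨ wt x , α n i ⟩ ⊕ ε̈ i x)
    Q3     : ∀ i → InI n i → ∀ x → ε̈ i x ≡ +∞ → (ë i x ≡ nothing) × (f̈ i x ≡ nothing)
    Q4     : ∀ i → InI n i → ∀ x → ε̈ i x ≡ -∞ → (ë i x ≡ nothing) × (f̈ i x ≡ nothing)

module _ {n : ℕ} (𝒬 : QuasiCrystal n) where
  open QuasiCrystal 𝒬

  IsMaxDefined : (Q → Maybe Q) → Q → ℕ → Set
  IsMaxDefined g x k = (iter g k x ≢ nothing) × (∀ m → iter g m x ≢ nothing → m ≤ k)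

  Seminormal : Set
  Seminormal = ∀ i → InI n i → ∀ x → ε̈ i x ≢ +∞ →
      (Σ ℕ λ k → (ε̈ i x ≡ fin (+ k)) × IsMaxDefined (ë i) x k)
    × (Σ ℕ λ k → (φ̈ i x ≡ fin (+ k)) × IsMaxDefined (f̈ i) x k)

  LQ1 : Set
  LQ1 = ∀ i → InI n i → InI n (suc i) → ∀ x →
      (ε̈ i x ≡ 0∞ → φ̈ (suc i) x ≡ 0∞) × (φ̈ (suc i) x ≡ 0∞ → ε̈ i x ≡ 0∞)

  LQ2 : Set
  LQ2 = ∀ i j → InI n i → InI n j → ∀ x y → ë i x ≡ just y →
      ((suc (suc i) ≤ j ⊎ suc (suc j) ≤ i) → ε̈ j x ≡ ε̈ j y)
    ×
      (InI n (suc i) →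
          (ε̈ (suc i) x ≢ ε̈ (suc i) y → (ε̈ (suc i) x ≡ +∞) × (ε̈ i y ≡ 0∞))
        × ((ε̈ (suc i) x ≡ +∞) × (ε̈ i y ≡ 0∞) → ε̈ (suc i) x ≢ ε̈ (suc i) y)
        × (ε̈ (suc i) x ≢ ε̈ (suc i) y → ε̈ (suc i) y ≢ 0∞))
    ×
      (InI n (pred i) →
          (φ̈ (pred i) x ≢ φ̈ (pred i) y → (φ̈ (pred i) y ≡ +∞) × (φ̈ i x ≡ 0∞))
        × ((φ̈ (pred i) y ≡ +∞) × (φ̈ i x ≡ 0∞) → φ̈ (pred i) x ≢ φ̈ (pred i) y)
        × (φ̈ (pred i) x ≢ φ̈ (pred i) y → φ̈ (pred i) x ≢ 0∞))

  NotZeroOrInf : ℤ∞ → Set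
  NotZeroOrInf v = (v ≢ 0∞) × (v ≢ +∞)

{-# OPTIONS --safe #-}
module Submission where

-- Along an ë_i-string the counter ε_i drops by one at each step, while by LQ2(2)
-- the value ε_{i+1} can only change when it is +∞ and ε_i has just reached 0, and
-- then it changes to a value other than 0.  Since e_i(x) = y, ε_i(y) is finite;
-- it is not 0, for otherwise LQ2(2) would force ε_{i+1} to change between x and y
-- although both values are +∞.  Hence ε_{i+1} stays +∞ for ε_i(y) steps and then
-- leaves {0, +∞}.  Part (2) is the same argument for f̈_i, φ_i and φ_{i-1}, with
-- LQ2(3) read from y back to x.

open import Defs
open import Data.Nat using (ℕ; zero; suc; pred; _≤_; _<_; z≤n; s≤s)
open import Data.Integer using (+_; -[1+_])
open import Data.Maybe using (Maybe; just; nothing)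
open import Data.Product using (Σ; _×_; _,_; proj₁; proj₂)
open import Data.Empty using (⊥-elim)
open import Relation.Nullary using (Dec; yes; no)
open import Relation.Binary.PropositionalEquality using (_≡_; _≢_; refl; sym; trans; ≢-sym)

_≟+∞ : (v : ℤ∞) → Dec (v ≡ +∞)
fin _ ≟+∞ = no λ ()
+∞    ≟+∞ = yes refl
-∞    ≟+∞ = no λ ()

fin-suc≢0∞ : ∀ {m} → fin (+ suc m) ≢ 0∞
fin-suc≢0∞ ()

fin≢+∞ : ∀ {c} → fin c ≢ +∞
fin≢+∞ ()

-1⊕fin-suc : ∀ {v k} → v ≡ fin (+ suc k) → (-[1+ 0 ] ⊕ v) ≡ fin (+ k)
-1⊕fin-suc refl = refl

1⊕-cancel : ∀ v k → (+ 1 ⊕ v) ≡ fin (+ suc k) → v ≡ fin (+ k)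
1⊕-cancel (fin (+ _))        _ refl = refl
1⊕-cancel (fin -[1+ zero ])  _ ()
1⊕-cancel (fin -[1+ suc _ ]) _ ()
1⊕-cancel +∞                 _ ()
1⊕-cancel -∞                 _ ()

module _ {A : Set} (g : A → Maybe A) where

  iter-suc-just : ∀ {x y} → g x ≡ just y → ∀ k → iter g (suc k) x ≡ iter g k y
  iter-suc-just e zero    = e
  iter-suc-just e (suc k) rewrite iter-suc-just e k = refl

  iter-suc-nothing : ∀ {x} → g x ≡ nothing → ∀ k → iter g (suc k) x ≡ nothing
  iter-suc-nothing e zero    = e
  iter-suc-nothing e (suc k) rewrite iter-suc-nothing e k = refl

  iter-suc-defined : ∀ {x} k → iter g (suc k) x ≢ nothing →
    Σ A λ y → (g x ≡ just y) × (iter g k y ≢ nothing)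
  iter-suc-defined {x} k def with g x in e
  ... | just y  = y , refl , λ eq → def (trans (iter-suc-just e k) eq)
  ... | nothing = ⊥-elim (def (iter-suc-nothing e k))

  Reaches : ℕ → A → (A → Set) → Set
  Reaches k x P = Σ A λ z → (iter g k x ≡ just z) × P z

  Reaches-suc : ∀ {x y P} → g x ≡ just y → ∀ k → Reaches k y P → Reaches (suc k) x P
  Reaches-suc e k (z , ez , pz) = z , trans (iter-suc-just e k) ez , pz

Nondegenerate : {A : Set} → (A → ℤ∞) → A → Set
Nondegenerate h z = (h z ≢ 0∞) × (h z ≢ +∞)

-- For ë_i the counter is ε_i and the guard ε_{i+1}, and the guard axioms are LQ2(2);
-- for f̈_i they are φ_i, φ_{i-1} and LQ2(3) with x and y exchanged.
record GuardedDescent (A : Set) : Set where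
  field
    step           : A → Maybe A
    counter guard  : A → ℤ∞
    counter-pred   : ∀ {a b k} → step a ≡ just b →
                     counter a ≡ fin (+ suc k) → counter b ≡ fin (+ k)
    counter-finite : ∀ {a b} → step a ≡ just b →
                     Σ ℕ λ k → (counter b ≡ fin (+ k)) × (iter step k b ≢ nothing)
    guard-change-source : ∀ {a b} → step a ≡ just b → guard a ≢ guard b →
                          (guard a ≡ +∞) × (counter b ≡ 0∞)
    guard-change-forced : ∀ {a b} → step a ≡ just b → guard a ≡ +∞ →
                          counter b ≡ 0∞ → guard a ≢ guard b
    guard-change-target≢0 : ∀ {a b} → step a ≡ just b → guard a ≢ guard b → guard b ≢ 0∞

  guard-∞-backward : ∀ {a b} → step a ≡ just b → guard b ≡ +∞ → guard a ≡ +∞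
  guard-∞-backward {a} e gb with guard a ≟+∞
  ... | yes ga = ga
  ... | no ga  = proj₁ (guard-change-source e λ eq → ga (trans eq gb))

  guard-∞-stays : ∀ {a b} → step a ≡ just b → guard a ≡ +∞ → counter b ≢ 0∞ → guard b ≡ +∞
  guard-∞-stays {b = b} e ga cb with guard b ≟+∞
  ... | yes gb = gb
  ... | no gb  = ⊥-elim (cb (proj₂ (guard-change-source e λ eq → gb (trans (sym eq) ga))))

  guard-∞-leaves : ∀ {a b} → step a ≡ just b → guard a ≡ +∞ → counter b ≡ 0∞ →
                   Nondegenerate guard b
  guard-∞-leaves e ga cb =
    guard-change-target≢0 e change , λ gb → change (trans ga (sym gb))
    where change = guard-change-forced e ga cb

  counter≢0-at-∞ : ∀ {a b} → step a ≡ just b → guard b ≡ +∞ → counter b ≢ 0∞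
  counter≢0-at-∞ e gb cb =
    guard-change-forced e (guard-∞-backward e gb) cb (trans (guard-∞-backward e gb) (sym gb))

  start-nondegenerate : ∀ {b m} → counter b ≡ fin (+ suc m) →
                        Reaches step 0 b (Nondegenerate counter)
  start-nondegenerate {b} cb =
    b , refl , (λ c0 → fin-suc≢0∞ (trans (sym cb) c0)) , λ c∞ → fin≢+∞ (trans (sym cb) c∞)

  walk : ∀ m {b} → counter b ≡ fin (+ suc m) → iter step (suc m) b ≢ nothing → guard b ≡ +∞ →
         Reaches step (suc m) b (Nondegenerate guard)
         × (∀ l → l < suc m → Reaches step l b (Nondegenerate counter))
  walk zero cb def gb =
    let (c , e , _) = iter-suc-defined step 0 def in
      Reaches-suc step e 0 (c , refl , guard-∞-leaves e gb (counter-pred e cb))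
    , λ { zero _ → start-nondegenerate cb ; (suc _) (s≤s ()) }
  walk (suc m) cb def gb =
    let (c , e , def′) = iter-suc-defined step (suc m) def
        cc = counter-pred e cb
        (reach , visited) = walk m cc def′ (guard-∞-stays e gb λ c0 → fin-suc≢0∞ (trans (sym cc) c0))
    in  Reaches-suc step e (suc m) reach
      , λ { zero _ → start-nondegenerate cb
          ; (suc l) (s≤s l<) → Reaches-suc step e l (visited l l<) }

  descent : ∀ {a b} → step a ≡ just b → guard b ≡ +∞ →
    Σ ℕ λ k → (0 < k)
      × Reaches step k b (Nondegenerate guard)
      × (∀ l → l < k → Reaches step l b (Nondegenerate counter))
  descent e gb with counter-finite e
  ... | zero  , c0 , _   = ⊥-elim (counter≢0-at-∞ e gb c0)
  ... | suc m , cm , def = suc m , s≤s z≤n , walk m cm def gb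

module _ {n : ℕ} (𝒬 : QuasiCrystal n) (sn : Seminormal 𝒬) (lq2 : LQ2 𝒬)
         {i : ℕ} (Ii : InI n i) where
  open QuasiCrystal 𝒬

  ë-defined⇒ε̈≢+∞ : ∀ {x y} → ë i x ≡ just y → ε̈ i x ≢ +∞
  ë-defined⇒ε̈≢+∞ {x} e x∞ with trans (sym e) (proj₁ (Q3 i Ii x x∞))
  ... | ()

  f̈-defined⇒ε̈≢+∞ : ∀ {x y} → f̈ i x ≡ just y → ε̈ i x ≢ +∞
  f̈-defined⇒ε̈≢+∞ {x} e x∞ with trans (sym e) (proj₂ (Q3 i Ii x x∞))
  ... | ()

  ë-descent : InI n (suc i) → GuardedDescent Q
  ë-descent Ii₊ = record
    { step    = ë i
    ; counter = ε̈ i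
    ; guard   = ε̈ (suc i)
    ; counter-pred = λ {a} {b} e ca → trans (Q1-ε i Ii a b e) (-1⊕fin-suc ca)
    ; counter-finite = λ {a} {b} e →
        let (k , ck , def , _) = proj₁ (sn i Ii b (f̈-defined⇒ε̈≢+∞ (Q1-ef i Ii a b e)))
        in k , ck , def
    ; guard-change-source   = λ e → proj₁ (LQ2-2 e)
    ; guard-change-forced   = λ e ga cb → proj₁ (proj₂ (LQ2-2 e)) (ga , cb)
    ; guard-change-target≢0 = λ e → proj₂ (proj₂ (LQ2-2 e))
    }
    where
    LQ2-2 : ∀ {a b} → ë i a ≡ just b →
        (ε̈ (suc i) a ≢ ε̈ (suc i) b → (ε̈ (suc i) a ≡ +∞) × (ε̈ i b ≡ 0∞))
      × ((ε̈ (suc i) a ≡ +∞) × (ε̈ i b ≡ 0∞) → ε̈ (suc i) a ≢ ε̈ (suc i) b)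
      × (ε̈ (suc i) a ≢ ε̈ (suc i) b → ε̈ (suc i) b ≢ 0∞)
    LQ2-2 {a} {b} e = proj₁ (proj₂ (lq2 i i Ii Ii a b e)) Ii₊

  f̈-descent : InI n (pred i) → GuardedDescent Q
  f̈-descent Ii₋ = record
    { step    = f̈ i
    ; counter = φ̈ i
    ; guard   = φ̈ (pred i)
    ; counter-pred = λ {a} {b} {k} e ca →
        1⊕-cancel (φ̈ i b) k (trans (sym (Q1-φ i Ii b a (ë-back e))) ca)
    ; counter-finite = λ e →
        let (k , ck , def , _) = proj₂ (sn i Ii _ (ë-defined⇒ε̈≢+∞ (ë-back e)))
        in k , ck , def
    ; guard-change-source   = λ e ne → proj₁ (LQ2-3 e) (≢-sym ne)
    ; guard-change-forced   = λ e ga cb → ≢-sym (proj₁ (proj₂ (LQ2-3 e)) (ga , cb))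
    ; guard-change-target≢0 = λ e ne → proj₂ (proj₂ (LQ2-3 e)) (≢-sym ne)
    }
    where
    ë-back : ∀ {a b} → f̈ i a ≡ just b → ë i b ≡ just a
    ë-back {a} {b} = Q1-fe i Ii b a
    LQ2-3 : ∀ {a b} → f̈ i a ≡ just b →
        (φ̈ (pred i) b ≢ φ̈ (pred i) a → (φ̈ (pred i) a ≡ +∞) × (φ̈ i b ≡ 0∞))
      × ((φ̈ (pred i) a ≡ +∞) × (φ̈ i b ≡ 0∞) → φ̈ (pred i) b ≢ φ̈ (pred i) a)
      × (φ̈ (pred i) b ≢ φ̈ (pred i) a → φ̈ (pred i) b ≢ 0∞)
    LQ2-3 {a} {b} e = proj₂ (proj₂ (lq2 i i Ii Ii b a (ë-back e))) Ii₋

corollary3p5 : {n : ℕ} → 2 ≤ n → (𝒬 : QuasiCrystal n) →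
    Seminormal 𝒬 → LQ1 𝒬 → LQ2 𝒬 →
    ∀ (x y : QuasiCrystal.Q 𝒬) (i : ℕ) → InI n i → QuasiCrystal.ë 𝒬 i x ≡ just y →
      (InI n (suc i) → QuasiCrystal.ε̈ 𝒬 (suc i) y ≡ +∞ →
        (QuasiCrystal.ε̈ 𝒬 (suc i) x ≡ +∞)
        × (Σ ℕ λ k → (0 < k)
            × (Σ (QuasiCrystal.Q 𝒬) λ z → (iter (QuasiCrystal.ë 𝒬 i) k y ≡ just z)
                 × NotZeroOrInf 𝒬 (QuasiCrystal.ε̈ 𝒬 (suc i) z))
            × (∀ l → l < k → Σ (QuasiCrystal.Q 𝒬) λ z → (iter (QuasiCrystal.ë 𝒬 i) l y ≡ just z)
                 × NotZeroOrInf 𝒬 (QuasiCrystal.ε̈ 𝒬 i z))))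
      × (InI n (pred i) → QuasiCrystal.φ̈ 𝒬 (pred i) x ≡ +∞ →
        (QuasiCrystal.φ̈ 𝒬 (pred i) y ≡ +∞)
        × (Σ ℕ λ k → (0 < k)
            × (Σ (QuasiCrystal.Q 𝒬) λ z → (iter (QuasiCrystal.f̈ 𝒬 i) k x ≡ just z)
                 × NotZeroOrInf 𝒬 (QuasiCrystal.φ̈ 𝒬 (pred i) z))
            × (∀ l → l < k → Σ (QuasiCrystal.Q 𝒬) λ z → (iter (QuasiCrystal.f̈ 𝒬 i) l x ≡ just z)
                 × NotZeroOrInf 𝒬 (QuasiCrystal.φ̈ 𝒬 i z))))
corollary3p5 _ 𝒬 sn _ lq2 x y i Ii e =
    (λ Ii₊ y∞ → let open GuardedDescent (ë-descent 𝒬 sn lq2 Ii Ii₊)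
                in guard-∞-backward e y∞ , descent e y∞)
  , (λ Ii₋ x∞ → let open GuardedDescent (f̈-descent 𝒬 sn lq2 Ii Ii₋)
                    f̈yx = QuasiCrystal.Q1-ef 𝒬 i Ii x y e
                in guard-∞-backward f̈yx x∞ , descent f̈yx x∞)
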